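{- Let \(\mathcal F\) be a minor-closed family of irreflexive graphs, \(\vec{\mathcal F}\) the set of all orientations of elements of \(\mathcal F\), and \(\vec{\mathcal F}_c\) the set of complete-convex orientations of elements of \(\mathcal F\). Then \(\chi_s(\vec{\mathcal F})=\chi(\vec{\mathcal F}_c)\).
   Context: Irreflexive means no loops; graphs have no parallel edges. A homomorphism \(\phi:\vec G\to\vec H\) of oriented graphs is a vertex map with \(\phi(u)\phi(v)\in A_{\vec H}\) for each arc \(uv\). For an irreflexive oriented graph \(\vec G\), \(\chi(\vec G)\) is the least \(k\) such that \(\vec G\) has a homomorphism to some loopless tournament on \(k\) vertices; \(\chi_s(\vec G)\) is the least \(k\) such that \(\vec G\) has a non-trivial homomorphism to a reflexive tournament (loop at every vertex) on \(k\) vertices, trivial meaning every arc is mapped to the same loop. For a family, \(\chi\) and \(\chi_s\) are the least \(k\) bounding the parameter over all members. A \(2\)-dipath \(u,v,w\) with centre \(v\): \(uv,vw\) arcs, \(u\ne v\ne w\). A vertex set \(S\) is convex if no vertex outside \(S\) is the centre of a \(2\)-dipath with ends in \(S\); \(conv(S)\) is the smallest convex superset; an oriented graph is complete convex if \(conv(\{u,v\})\) is the whole vertex set for every arc \(uv\). -}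

module Defs where

open import Data.Nat using (ℕ; _≤_)
open import Data.Fin using (Fin)
open import Data.Bool using (Bool; true; false; _∨_; not)
open import Data.Maybe using (Maybe; just)
open import Data.Product using (Σ; ∃; ∃-syntax; _×_)
open import Relation.Binary.PropositionalEquality using (_≡_; _≢_)
open import Relation.Nullary using (¬_)
open import Data.Empty using (⊥)
open import Data.Fin.Subset using (Subset; _∈_; _∉_; _⊆_; ⁅_⁆; _∪_)

record Graph (n : ℕ) : Set where
  field
    adj    : Fin n → Fin n → Bool
    sym    : ∀ u v → adj u v ≡ adj v u
    irrefl : ∀ u → adj u u ≡ false
open Graph public

HasEdge : ∀ {n} → Graph n → Set
HasEdge {n} G = Σ (Fin n) λ u → Σ (Fin n) λ v → adj G u v ≡ true

-- Minors (via minor models / branch sets).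
-- branch v = just i means vertex v of G lies in the branch set of i.

data PathIn {n : ℕ} (G : Graph n) (P : Fin n → Set) : Fin n → Fin n → Set where
  here : ∀ {v} → PathIn G P v v
  step : ∀ {v x w} → adj G v x ≡ true → P x → PathIn G P x w → PathIn G P v w

record MinorModel {m n : ℕ} (H : Graph m) (G : Graph n) : Set where
  field
    branch    : Fin n → Maybe (Fin m)
    nonempty  : ∀ i → ∃[ v ] branch v ≡ just i
    connected : ∀ i v w → branch v ≡ just i → branch w ≡ just i →
                PathIn G (λ x → branch x ≡ just i) v w
    edges     : ∀ i j → adj H i j ≡ true →
                Σ (Fin n) λ v → Σ (Fin n) λ w →
                  branch v ≡ just i × branch w ≡ just j × adj G v w ≡ true

_≼_ : ∀ {m n} → Graph m → Graph n → Set
H ≼ G = MinorModel H G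

Family : Set₁
Family = ∀ {n} → Graph n → Set

MinorClosed : Family → Set
MinorClosed F = ∀ {m n} (G : Graph n) (H : Graph m) → F G → H ≼ G → F H

record OGraph (n : ℕ) : Set where
  field
    arc     : Fin n → Fin n → Bool
    irrefl  : ∀ u → arc u u ≡ false
    antisym : ∀ u v → arc u v ≡ true → arc v u ≡ false
open OGraph public

HasArc : ∀ {n} → OGraph n → Set
HasArc {n} D = Σ (Fin n) λ u → Σ (Fin n) λ v → arc D u v ≡ true

IsOrientation : ∀ {n} → Graph n → OGraph n → Set
IsOrientation G D = ∀ u v → adj G u v ≡ (arc D u v ∨ arc D v u)

Convex : ∀ {n} → OGraph n → Subset n → Set
Convex {n} D S = ∀ (a b c : Fin n) → a ∈ S → c ∈ S →
  arc D a b ≡ true → arc D b c ≡ true → b ∉ S → ⊥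

-- x ∈ conv(S): x lies in every convex superset of S
-- (conv(S) = smallest convex superset = intersection of convex supersets).
InConv : ∀ {n} → OGraph n → Subset n → Fin n → Set
InConv D S x = ∀ T → Convex D T → S ⊆ T → x ∈ T

CompleteConvex : ∀ {n} → OGraph n → Set
CompleteConvex {n} D = ∀ u v → arc D u v ≡ true → ∀ x → InConv D (⁅ u ⁆ ∪ ⁅ v ⁆) x

record Tournament (k : ℕ) : Set where
  field
    tarc    : Fin k → Fin k → Bool
    tloop   : ∀ u → tarc u u ≡ false
    tourn   : ∀ u v → u ≢ v → tarc u v ≡ not (tarc v u)
open Tournament public

record RTournament (k : ℕ) : Set where
  field
    rarc    : Fin k → Fin k → Bool
    rloop   : ∀ u → rarc u u ≡ true
    rtourn  : ∀ u v → u ≢ v → rarc u v ≡ not (rarc v u)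
open RTournament public

IsHomT : ∀ {n k} → OGraph n → Tournament k → (Fin n → Fin k) → Set
IsHomT D T φ = ∀ u v → arc D u v ≡ true → tarc T (φ u) (φ v) ≡ true

IsHomR : ∀ {n k} → OGraph n → RTournament k → (Fin n → Fin k) → Set
IsHomR D T φ = ∀ u v → arc D u v ≡ true → rarc T (φ u) (φ v) ≡ true

Trivial : ∀ {n k} → OGraph n → (Fin n → Fin k) → Set
Trivial {n} {k} D φ = Σ (Fin k) λ x → ∀ u v → arc D u v ≡ true → φ u ≡ x × φ v ≡ x

χ≤ : ∀ {n} → OGraph n → ℕ → Set
χ≤ {n} D k = Σ ℕ λ j → j ≤ k × Σ (Tournament j) λ T →
  Σ (Fin n → Fin j) λ φ → IsHomT D T φ

χs≤ : ∀ {n} → OGraph n → ℕ → Set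
χs≤ {n} D k = Σ ℕ λ j → j ≤ k × Σ (RTournament j) λ T →
  Σ (Fin n → Fin j) λ φ → IsHomR D T φ × ¬ Trivial D φ

χsFamily≤ : Family → ℕ → Set
χsFamily≤ F k = ∀ {n} (G : Graph n) (D : OGraph n) →
  F G → IsOrientation G D → HasArc D → χs≤ D k

χcFamily≤ : Family → ℕ → Set
χcFamily≤ F k = ∀ {n} (G : Graph n) (D : OGraph n) →
  F G → IsOrientation G D → CompleteConvex D → χ≤ D k

-- If D is complete convex, a non-trivial homomorphism to a reflexive tournament has no
-- monochromatic arc: colour classes are convex, and the hull of a monochromatic arc would be
-- everything.  So removing the loops gives a homomorphism to a loopless tournament, while
-- adding loops to a tournament always gives a non-trivial homomorphism.  For an arbitrary
-- orientation D of a member of F argue by induction on the number of vertices: either D is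
-- complete convex, or some arc ab has a proper convex hull H, which is connected in the
-- underlying graph.  If an arc leaves H, contract H (its convexity prevents digons);
-- otherwise all arcs lie in H and the vertices outside H can be deleted.  Both give a smaller
-- oriented minor in the family, whose non-trivial homomorphism pulls back to D.

module Submission where

open import Defs hiding (sym)
open import Data.Bool using (true; false; _∨_; _∧_; not)
open import Data.Bool.Properties using (∨-zeroʳ; ∨-identityʳ; ∨-comm; ∧-conicalˡ) renaming (_≟_ to _≟ᵇ_)
open import Data.Empty using (⊥)
open import Data.Fin using (Fin; zero; suc; _≟_; _<?_)
open import Data.Fin.Properties using (any?; <-cmp; <-asym; nonZeroIndex)
open import Data.Fin.Subset using (Subset; _∈_; _∉_; _⊆_; _⊂_; ⁅_⁆; _∪_; ∣_∣; outside; inside; Empty; ⊤)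
  renaming (⊥ to ∅)
open import Data.Fin.Subset.Properties
  using (_∈?_; x∈⁅x⁆; x∈⁅y⁆⇒x≡y; x∈p∪q⁻; x∈p∪q⁺; ∣p∣≤n; p⊂q⇒∣p∣<∣q∣; drop-∷-⊆; nonempty?; ∈⊤; ⊆⊤; ∉⊥; ⊥⊆)
open import Data.Maybe using (Maybe; just; nothing)
import Data.Maybe as Maybe
open import Data.Maybe.Properties using (just-injective) renaming (≡-dec to ≡-decᴹ)
open import Data.Nat using (ℕ; zero; suc; _+_; _≤_; _<_; z≤n; s≤s; >-nonZero⁻¹)
open import Data.Nat.Induction using (<-rec)
open import Data.Nat.Properties using (≤-trans; <⇒≱; ≤-<-trans; ≤-pred; +-monoʳ-<; m≤m+n; m≤n⇒m≤1+n)
open import Data.Product using (Σ; ∃; ∃₂; _×_; _,_; proj₁; proj₂)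
import Data.Product as Prod
open import Data.Sum using (_⊎_; inj₁; inj₂)
import Data.Sum as Sum
open import Data.Vec using ([]; _∷_; here; there; tabulate)
open import Data.Vec.Properties using (lookup∘tabulate; []=⇒lookup; lookup⇒[]=)
open import Function using (_∘_; const; id)
open import Function.Bundles using (_⇔_; mk⇔)
open import Relation.Binary.Definitions using (tri<; tri≈; tri>)
open import Relation.Binary.PropositionalEquality using (_≡_; _≢_; refl; sym; trans; cong; subst₂)
open import Relation.Nullary using (¬_; Dec; yes; no; does; contradiction)
open import Relation.Nullary.Decidable using (dec-true; dec-false; decidable-stable; _×-dec_; _⊎-dec_; ¬?)
open import Relation.Unary using (Decidable)

does-true : ∀ {P : Set} (P? : Dec P) → does P? ≡ true → P
does-true (yes p) _ = p
does-true (no _) ()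

∨-true : ∀ {x y} → x ∨ y ≡ true → x ≡ true ⊎ y ≡ true
∨-true {true} _ = inj₁ refl
∨-true {false} y = inj₂ y

true≢false : true ≢ false
true≢false ()

subsetOf : ∀ {n} {P : Fin n → Set} → Decidable P → Subset n
subsetOf P? = tabulate (does ∘ P?)

module _ {n} {P : Fin n → Set} (P? : Decidable P) {x : Fin n} where

  ∈-subsetOf⁺ : P x → x ∈ subsetOf P?
  ∈-subsetOf⁺ p = lookup⇒[]= x _ (trans (lookup∘tabulate _ x) (dec-true (P? x) p))

  ∈-subsetOf⁻ : x ∈ subsetOf P? → P x
  ∈-subsetOf⁻ x∈ = does-true (P? x) (trans (sym (lookup∘tabulate _ x)) ([]=⇒lookup x∈))

module _ {n} {u v : Fin n} where

  ∈-pair⁻ : ∀ {y} → y ∈ ⁅ u ⁆ ∪ ⁅ v ⁆ → y ≡ u ⊎ y ≡ v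
  ∈-pair⁻ y∈ = Sum.map (x∈⁅y⁆⇒x≡y u) (x∈⁅y⁆⇒x≡y v) (x∈p∪q⁻ ⁅ u ⁆ ⁅ v ⁆ y∈)

  u∈pair : u ∈ ⁅ u ⁆ ∪ ⁅ v ⁆
  u∈pair = x∈p∪q⁺ (inj₁ (x∈⁅x⁆ u))

  v∈pair : v ∈ ⁅ u ⁆ ∪ ⁅ v ⁆
  v∈pair = x∈p∪q⁺ (inj₂ (x∈⁅x⁆ v))

  pair⊆ : ∀ {T} → u ∈ T → v ∈ T → ⁅ u ⁆ ∪ ⁅ v ⁆ ⊆ T
  pair⊆ u∈T v∈T y∈ with ∈-pair⁻ y∈
  ... | inj₁ refl = u∈T
  ... | inj₂ refl = v∈T

mapPath : ∀ {n} {G : Graph n} {P Q : Fin n → Set} → (∀ {z} → P z → Q z) →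
          ∀ {x y} → PathIn G P x y → PathIn G Q x y
mapPath f here = here
mapPath f (step e p r) = step e (f p) (mapPath f r)

infixr 5 _++ᵖ_
_++ᵖ_ : ∀ {n} {G : Graph n} {P : Fin n → Set} {x y z} → PathIn G P x y → PathIn G P y z → PathIn G P x z
here ++ᵖ r = r
step e p r ++ᵖ r′ = step e p (r ++ᵖ r′)

Connected : ∀ {n} → Graph n → Subset n → Set
Connected G S = ∀ {v w} → v ∈ S → w ∈ S → PathIn G (_∈ S) v w

module _ {n} (D : OGraph n) where

  arc⇒≢ : ∀ {a b} → arc D a b ≡ true → a ≢ b
  arc⇒≢ {a} aa refl = true≢false (trans (sym aa) (OGraph.irrefl D a))

  convex-centre : ∀ {S a b c} → Convex D S → a ∈ S → c ∈ S →
                  arc D a b ≡ true → arc D b c ≡ true → b ∈ S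
  convex-centre {S} {a} {b} {c} S-convex a∈S c∈S ab bc =
    decidable-stable (b ∈? S) (S-convex a b c a∈S c∈S ab bc)

  ArcsWithin : Subset n → Set
  ArcsWithin S = ∀ {a b} → arc D a b ≡ true → a ∈ S × b ∈ S

  arcsWithin⊎arcLeaving : ∀ S → ArcsWithin S ⊎ ∃₂ λ c d → arc D c d ≡ true × ¬ (c ∈ S × d ∈ S)
  arcsWithin⊎arcLeaving S
    with any? (λ c → any? λ d → (arc D c d ≟ᵇ true) ×-dec ¬? ((c ∈? S) ×-dec (d ∈? S)))
  ... | yes leaving = inj₂ leaving
  ... | no noneLeaving = inj₁ λ {c} {d} cd →
          decidable-stable ((c ∈? S) ×-dec (d ∈? S)) λ notBoth → noneLeaving (c , d , cd , notBoth)

  hasArc? : Dec (HasArc D)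
  hasArc? = any? λ u → any? λ v → arc D u v ≟ᵇ true

module OrientedArcs {n} (G : Graph n) (D : OGraph n) (orient : IsOrientation G D) where

  arc⇒adj : ∀ {a b} → arc D a b ≡ true → adj G a b ≡ true
  arc⇒adj {a} {b} ab = trans (orient a b) (cong (_∨ arc D b a) ab)

  arc⇒adjᵒ : ∀ {a b} → arc D a b ≡ true → adj G b a ≡ true
  arc⇒adjᵒ {a} {b} ab = trans (orient b a) (trans (cong (arc D b a ∨_) ab) (∨-zeroʳ _))

underlying : ∀ {n} → OGraph n → Graph n
underlying D = record
  { adj = λ u v → arc D u v ∨ arc D v u
  ; sym = λ u v → ∨-comm (arc D u v) (arc D v u)
  ; irrefl = λ u → trans (cong (_∨ arc D u u) (OGraph.irrefl D u)) (OGraph.irrefl D u) }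

orientByIndex : ∀ {n} → Graph n → OGraph n
orientByIndex G = record
  { arc = λ a b → does (a <? b) ∧ adj G a b
  ; irrefl = λ a → cong (_∧ adj G a a) (dec-false (a <? a) (λ a<a → <-asym a<a a<a))
  ; antisym = antisym′ }
  where
    antisym′ : ∀ a b → does (a <? b) ∧ adj G a b ≡ true → does (b <? a) ∧ adj G b a ≡ false
    antisym′ a b ab =
      cong (_∧ adj G b a) (dec-false (b <? a) (<-asym (does-true (a <? b) (∧-conicalˡ _ _ ab))))

module _ {n} (G : Graph n) where

  orientByIndex-orientation : IsOrientation G (orientByIndex G)
  orientByIndex-orientation a b with <-cmp a b
  ... | tri< a<b _ b≮a rewrite dec-true (a <? b) a<b | dec-false (b <? a) b≮a = sym (∨-identityʳ _)
  ... | tri≈ _ refl _ rewrite dec-false (a <? a) (λ a<a → <-asym a<a a<a) = Graph.irrefl G a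
  ... | tri> a≮b _ b<a rewrite dec-false (a <? b) a≮b | dec-true (b <? a) b<a = Graph.sym G a b

  orientByIndex-hasArc : HasEdge G → HasArc (orientByIndex G)
  orientByIndex-hasArc (u , v , uv) with ∨-true (trans (sym (orientByIndex-orientation u v)) uv)
  ... | inj₁ u→v = u , v , u→v
  ... | inj₂ v→u = v , u , v→u

rtourn-asym : ∀ {k} (T : RTournament k) {x y} → x ≢ y → rarc T x y ≡ true → rarc T y x ≡ true → ⊥
rtourn-asym T {x} {y} x≢y xy yx = true≢false (trans (sym xy) (trans (rtourn T x y x≢y) (cong not yx)))

loopless : ∀ {k} → RTournament k → Tournament k
loopless T = record
  { tarc = λ x y → not (does (x ≟ y)) ∧ rarc T x y
  ; tloop = λ x → cong (λ b → not b ∧ rarc T x x) (dec-true (x ≟ x) refl)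
  ; tourn = tourn′ }
  where
    tourn′ : ∀ x y → x ≢ y → not (does (x ≟ y)) ∧ rarc T x y ≡ not (not (does (y ≟ x)) ∧ rarc T y x)
    tourn′ x y x≢y rewrite dec-false (x ≟ y) x≢y | dec-false (y ≟ x) (x≢y ∘ sym) = rtourn T x y x≢y

reflexive : ∀ {k} → Tournament k → RTournament k
reflexive T = record
  { rarc = λ x y → does (x ≟ y) ∨ tarc T x y
  ; rloop = λ x → cong (_∨ tarc T x x) (dec-true (x ≟ x) refl)
  ; rtourn = rtourn′ }
  where
    rtourn′ : ∀ x y → x ≢ y → does (x ≟ y) ∨ tarc T x y ≡ not (does (y ≟ x) ∨ tarc T y x)
    rtourn′ x y x≢y rewrite dec-false (x ≟ y) x≢y | dec-false (y ≟ x) (x≢y ∘ sym) = tourn T x y x≢y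

singletonTournament : Tournament 1
singletonTournament = record
  { tarc = λ _ _ → false ; tloop = λ _ → refl ; tourn = λ { zero zero 0≢0 → contradiction refl 0≢0 } }

module _ {n j} (D : OGraph n) (T : RTournament j) (φ : Fin n → Fin j) (hom : IsHomR D T φ) where

  hasColour? : ∀ c x → Dec (φ x ≡ c)
  hasColour? c x = φ x ≟ c

  colourClass : Fin j → Subset n
  colourClass c = subsetOf (hasColour? c)

  colourClass-convex : ∀ c → Convex D (colourClass c)
  colourClass-convex c a b d a∈ d∈ ab bd b∉ =
    rtourn-asym T (b∉ ∘ ∈-subsetOf⁺ (hasColour? c) ∘ sym) c→φb φb→c
    where
      c→φb : rarc T c (φ b) ≡ true
      c→φb = subst₂ (λ x y → rarc T x y ≡ true) (∈-subsetOf⁻ (hasColour? c) a∈) refl (hom a b ab)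
      φb→c : rarc T (φ b) c ≡ true
      φb→c = subst₂ (λ x y → rarc T x y ≡ true) refl (∈-subsetOf⁻ (hasColour? c) d∈) (hom b d bd)

  completeConvex⇒properColouring : CompleteConvex D → ¬ Trivial D φ →
                                   ∀ {u v} → arc D u v ≡ true → φ u ≢ φ v
  completeConvex⇒properColouring cc nontrivial {u} {v} uv φu≡φv =
    nontrivial (φ u , λ a b _ → monochrome a , monochrome b)
    where
      monochrome : ∀ x → φ x ≡ φ u
      monochrome x = ∈-subsetOf⁻ (hasColour? (φ u))
        (cc u v uv x (colourClass (φ u)) (colourClass-convex (φ u))
            (pair⊆ (∈-subsetOf⁺ (hasColour? (φ u)) refl) (∈-subsetOf⁺ (hasColour? (φ u)) (sym φu≡φv))))

completeConvex-χs≤⇒χ≤ : ∀ {n k} (D : OGraph n) → CompleteConvex D → χs≤ D k → χ≤ D k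
completeConvex-χs≤⇒χ≤ D cc (j , j≤k , T , φ , hom , nontrivial) =
  j , j≤k , loopless T , φ , loopless-hom
  where
    loopless-hom : IsHomT D (loopless T) φ
    loopless-hom u v uv
      rewrite dec-false (φ u ≟ φ v) (completeConvex⇒properColouring D T φ hom cc nontrivial uv) = hom u v uv

χ≤⇒χs≤ : ∀ {n k} (D : OGraph n) → HasArc D → χ≤ D k → χs≤ D k
χ≤⇒χs≤ D (u , v , uv) (j , j≤k , T , φ , hom) =
  j , j≤k , reflexive T , φ , reflexive-hom , nontrivial
  where
    reflexive-hom : IsHomR D (reflexive T) φ
    reflexive-hom a b ab rewrite hom a b ab = ∨-zeroʳ _
    nontrivial : ¬ Trivial D φ
    nontrivial (c , trivial) = true≢false (trans (sym loop) (tloop T c))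
      where
        loop : tarc T c c ≡ true
        loop = subst₂ (λ x y → tarc T x y ≡ true) (proj₁ (trivial u v uv)) (proj₂ (trivial u v uv)) (hom u v uv)

arcless-χ≤ : ∀ {n k} (D : OGraph n) → ¬ HasArc D → 1 ≤ k → χ≤ D k
arcless-χ≤ _ noArc 1≤k = 1 , 1≤k , singletonTournament , const zero , λ u v uv → contradiction (u , v , uv) noArc

χs≤⇒1≤ : ∀ {n k} (D : OGraph n) → HasArc D → χs≤ D k → 1 ≤ k
χs≤⇒1≤ _ (u , _) (j , j≤k , _ , φ , _) = ≤-trans (>-nonZero⁻¹ j {{nonZeroIndex (φ u)}}) j≤k

-- The edge of G₀ only serves to show k ≥ 1, which arcless members need.
χsFamily≤⇒χcFamily≤ : ∀ {F : Family} {k} → (Σ ℕ λ n → Σ (Graph n) λ G → F G × HasEdge G) →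
                      χsFamily≤ F k → χcFamily≤ F k
χsFamily≤⇒χcFamily≤ (_ , G₀ , F-G₀ , edge) χs G D F-G orient cc with hasArc? D
... | yes hasArc = completeConvex-χs≤⇒χ≤ D cc (χs G D F-G orient hasArc)
... | no noArc =
  arcless-χ≤ D noArc (χs≤⇒1≤ D₀ arc₀ (χs G₀ D₀ F-G₀ (orientByIndex-orientation G₀) arc₀))
  where
    D₀ : OGraph _
    D₀ = orientByIndex G₀
    arc₀ : HasArc D₀
    arc₀ = orientByIndex-hasArc G₀ edge

-- Convex hulls

module ConvexHull {n} (D : OGraph n) where

  Centre : Subset n → Fin n → Set
  Centre R b = ∃₂ λ a c → a ∈ R × c ∈ R × arc D a b ≡ true × arc D b c ≡ true

  centre? : ∀ R b → Dec (Centre R b)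
  centre? R b = any? λ a → any? λ c →
    (a ∈? R) ×-dec (c ∈? R) ×-dec (arc D a b ≟ᵇ true) ×-dec (arc D b c ≟ᵇ true)

  inR⊎centre? : ∀ R b → Dec (b ∈ R ⊎ Centre R b)
  inR⊎centre? R b = (b ∈? R) ⊎-dec centre? R b

  expand : Subset n → Subset n
  expand R = subsetOf (inR⊎centre? R)

  ⊆-expand : ∀ {R} → R ⊆ expand R
  ⊆-expand {R} b∈R = ∈-subsetOf⁺ (inR⊎centre? R) (inj₁ b∈R)

  expand-⊆ : ∀ {R T} → Convex D T → R ⊆ T → expand R ⊆ T
  expand-⊆ {R} T-convex R⊆T b∈ with ∈-subsetOf⁻ (inR⊎centre? R) b∈
  ... | inj₁ b∈R = R⊆T b∈R
  ... | inj₂ (a , c , a∈R , c∈R , ab , bc) = convex-centre D T-convex (R⊆T a∈R) (R⊆T c∈R) ab bc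

  Violation : Subset n → Set
  Violation R = ∃ λ b → b ∉ R × Centre R b

  violation? : ∀ R → Dec (Violation R)
  violation? R = any? λ b → ¬? (b ∈? R) ×-dec centre? R b

  hullFrom : ℕ → Subset n → Subset n
  hullFrom zero R = R
  hullFrom (suc f) R with violation? R
  ... | yes _ = hullFrom f (expand R)
  ... | no _ = R

  hullFrom-preserves : (P : Subset n → Set) → (∀ {R} → P R → P (expand R)) →
                       ∀ f {R} → P R → P (hullFrom f R)
  hullFrom-preserves P expand-P zero pR = pR
  hullFrom-preserves P expand-P (suc f) {R} pR with violation? R
  ... | yes _ = hullFrom-preserves P expand-P f (expand-P pR)
  ... | no _ = pR

  -- Each expansion step adds a vertex, so the fuel f suffices once it covers the missing vertices.
  hullFrom-convex : ∀ f R → n < f + ∣ R ∣ → Convex D (hullFrom f R)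
  hullFrom-convex zero R n<∣R∣ = contradiction (∣p∣≤n R) (<⇒≱ n<∣R∣)
  hullFrom-convex (suc f) R n< with violation? R
  ... | yes (b , b∉R , b-centre) =
        hullFrom-convex f (expand R) (≤-<-trans (≤-pred n<) (+-monoʳ-< f (p⊂q⇒∣p∣<∣q∣ R⊂expandR)))
    where
      R⊂expandR : R ⊂ expand R
      R⊂expandR = ⊆-expand , b , ∈-subsetOf⁺ (inR⊎centre? R) (inj₂ b-centre) , b∉R
  ... | no noViolation = λ a b c a∈R c∈R ab bc b∉R → noViolation (b , b∉R , a , c , a∈R , c∈R , ab , bc)

  hull : Fin n → Fin n → Subset n
  hull u v = hullFrom (suc n) (⁅ u ⁆ ∪ ⁅ v ⁆)

  hull-convex : ∀ u v → Convex D (hull u v)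
  hull-convex _ _ = hullFrom-convex (suc n) _ (s≤s (m≤m+n n _))

  pair⊆hull : ∀ {u v} → ⁅ u ⁆ ∪ ⁅ v ⁆ ⊆ hull u v
  pair⊆hull {u} {v} =
    hullFrom-preserves (⁅ u ⁆ ∪ ⁅ v ⁆ ⊆_) (λ R⊆ x∈ → ⊆-expand (R⊆ x∈)) (suc n) (λ x∈ → x∈)

  ∈-hullˡ : ∀ u v → u ∈ hull u v
  ∈-hullˡ _ _ = pair⊆hull u∈pair

  ∈-hullʳ : ∀ u v → v ∈ hull u v
  ∈-hullʳ _ _ = pair⊆hull v∈pair

  hull-least : ∀ {u v T} → Convex D T → ⁅ u ⁆ ∪ ⁅ v ⁆ ⊆ T → hull u v ⊆ T
  hull-least {T = T} T-convex = hullFrom-preserves (_⊆ T) (expand-⊆ T-convex) (suc n)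

  completeConvex⊎properHull : CompleteConvex D ⊎ ∃₂ λ a b → arc D a b ≡ true × ∃ λ x → x ∉ hull a b
  completeConvex⊎properHull
    with any? (λ a → any? λ b → (arc D a b ≟ᵇ true) ×-dec any? λ x → ¬? (x ∈? hull a b))
  ... | yes proper = inj₂ proper
  ... | no notProper = inj₁ λ u v uv x T T-convex pair⊆T →
          hull-least T-convex pair⊆T (decidable-stable (x ∈? hull u v) λ x∉ → notProper (u , v , uv , x , x∉))

  module _ {G : Graph n} (orient : IsOrientation G D) where
    open OrientedArcs G D orient

    LinkedTo : Fin n → Subset n → Set
    LinkedTo u R = ∀ {y} → y ∈ R → PathIn G (_∈ R) u y × PathIn G (_∈ R) y u

    expand-linked : ∀ {u R} → LinkedTo u R → LinkedTo u (expand R)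
    expand-linked {R = R} linked y∈ with ∈-subsetOf⁻ (inR⊎centre? R) y∈
    ... | inj₁ y∈R = Prod.map widen widen (linked y∈R)
      where widen = mapPath ⊆-expand
    ... | inj₂ (a , c , a∈R , c∈R , ay , yc) =
          mapPath ⊆-expand (proj₁ (linked a∈R)) ++ᵖ step (arc⇒adj ay) y∈ here ,
          step (arc⇒adj yc) (⊆-expand c∈R) (mapPath ⊆-expand (proj₂ (linked c∈R)))

    hull-connected : ∀ {u v} → arc D u v ≡ true → Connected G (hull u v)
    hull-connected {u} {v} uv v∈ w∈ = proj₂ (linked v∈) ++ᵖ proj₁ (linked w∈)
      where
        pair-linked : LinkedTo u (⁅ u ⁆ ∪ ⁅ v ⁆)
        pair-linked y∈ with ∈-pair⁻ y∈
        ... | inj₁ refl = here , here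
        ... | inj₂ refl = step (arc⇒adj uv) y∈ here , step (arc⇒adjᵒ uv) u∈pair here
        linked : LinkedTo u (hull u v)
        linked = hullFrom-preserves (LinkedTo u) expand-linked (suc n) pair-linked

-- Quotients by deletion and contraction

-- Keeps the vertices of K and identifies those of S and nothing else; nothing marks a deleted vertex.
record Quotient {n : ℕ} (K S : Subset n) : Set where
  field
    size            : ℕ
    proj            : Fin n → Maybe (Fin size)
    proj-kept       : ∀ {x} → x ∈ K → ∃ λ i → proj x ≡ just i
    proj-surjective : ∀ i → ∃ λ x → proj x ≡ just i
    proj-merges     : ∀ {x y} → x ∈ S → y ∈ S → proj x ≡ proj y
    proj-separates  : ∀ {x y i} → proj x ≡ just i → proj y ≡ just i → x ≡ y ⊎ (x ∈ S × y ∈ S)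
    size≤           : size ≤ n
    size<-delete    : ∀ {x} → x ∉ K → size < n
    size<-merge     : ∀ {x y} → x ≢ y → x ∈ S → y ∈ S → size < n

emptyQuotient : Quotient [] []
emptyQuotient = record
  { size = 0 ; proj = λ () ; proj-kept = λ () ; proj-surjective = λ ()
  ; proj-merges = λ () ; proj-separates = λ { {()} } ; size≤ = z≤n
  ; size<-delete = λ { {()} } ; size<-merge = λ _ () }

suc-separated : ∀ {n s} {S : Subset n} {x y} → x ≡ y ⊎ (x ∈ S × y ∈ S) →
                suc x ≡ suc y ⊎ (suc x ∈ s ∷ S × suc y ∈ s ∷ S)
suc-separated = Sum.map (cong suc) (Prod.map there there)

map-suc≡just⁻ : ∀ {m} (a : Maybe (Fin m)) {i} → Maybe.map suc a ≡ just i → ∃ λ j → i ≡ suc j × a ≡ just j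
map-suc≡just⁻ (just j) refl = j , refl , refl

module _ {n} {K S : Subset n} (Q : Quotient K S) where
  open Quotient Q

  dropHead : Quotient (outside ∷ K) (outside ∷ S)
  dropHead = record
    { size = size
    ; proj = proj′
    ; proj-kept = λ { (there x∈K) → proj-kept x∈K }
    ; proj-surjective = λ i → Prod.map suc id (proj-surjective i)
    ; proj-merges = λ { (there x∈S) (there y∈S) → proj-merges x∈S y∈S }
    ; proj-separates = separates
    ; size≤ = m≤n⇒m≤1+n size≤
    ; size<-delete = λ _ → s≤s size≤
    ; size<-merge = λ _ _ _ → s≤s size≤ }
    where
      proj′ : Fin (suc n) → Maybe (Fin size)
      proj′ zero = nothing
      proj′ (suc x) = proj x
      separates : ∀ {x y i} → proj′ x ≡ just i → proj′ y ≡ just i →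
                  x ≡ y ⊎ (x ∈ outside ∷ S × y ∈ outside ∷ S)
      separates {suc x} {suc y} px py = suc-separated (proj-separates px py)

  freshHead : ∀ {s} → (zero ∈ s ∷ S → Empty S) → Quotient (inside ∷ K) (s ∷ S)
  freshHead {s} lonely = record
    { size = suc size
    ; proj = proj′
    ; proj-kept = kept
    ; proj-surjective = surjective
    ; proj-merges = merges
    ; proj-separates = separates
    ; size≤ = s≤s size≤
    ; size<-delete = delete<
    ; size<-merge = merge< }
    where
      proj′ : Fin (suc n) → Maybe (Fin (suc size))
      proj′ zero = just zero
      proj′ (suc x) = Maybe.map suc (proj x)
      kept : ∀ {x} → x ∈ inside ∷ K → ∃ λ i → proj′ x ≡ just i
      kept here = zero , refl
      kept (there x∈K) = Prod.map suc (cong (Maybe.map suc)) (proj-kept x∈K)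
      surjective : ∀ i → ∃ λ x → proj′ x ≡ just i
      surjective zero = zero , refl
      surjective (suc i) = Prod.map suc (cong (Maybe.map suc)) (proj-surjective i)
      merges : ∀ {x y} → x ∈ s ∷ S → y ∈ s ∷ S → proj′ x ≡ proj′ y
      merges here here = refl
      merges here (there y∈S) = contradiction (_ , y∈S) (lonely here)
      merges (there x∈S) here = contradiction (_ , x∈S) (lonely here)
      merges (there x∈S) (there y∈S) = cong (Maybe.map suc) (proj-merges x∈S y∈S)
      separates : ∀ {x y i} → proj′ x ≡ just i → proj′ y ≡ just i → x ≡ y ⊎ (x ∈ s ∷ S × y ∈ s ∷ S)
      separates {zero} {zero} _ _ = inj₁ refl
      separates {zero} {suc y} refl py with map-suc≡just⁻ (proj y) py
      ... | _ , () , _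
      separates {suc x} {zero} px refl with map-suc≡just⁻ (proj x) px
      ... | _ , () , _
      separates {suc x} {suc y} px py with map-suc≡just⁻ (proj x) px | map-suc≡just⁻ (proj y) py
      ... | _ , refl , px′ | _ , refl , py′ = suc-separated (proj-separates px′ py′)
      delete< : ∀ {x} → x ∉ inside ∷ K → suc size < suc n
      delete< {zero} x∉ = contradiction here x∉
      delete< {suc x} x∉ = s≤s (size<-delete (x∉ ∘ there))
      merge< : ∀ {x y} → x ≢ y → x ∈ s ∷ S → y ∈ s ∷ S → suc size < suc n
      merge< x≢y here here = contradiction refl x≢y
      merge< _ here (there y∈S) = contradiction (_ , y∈S) (lonely here)
      merge< _ (there x∈S) here = contradiction (_ , x∈S) (lonely here)
      merge< x≢y (there x∈S) (there y∈S) = s≤s (size<-merge (x≢y ∘ cong suc) x∈S y∈S)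

  mergeHead : ∀ {w} → w ∈ K → w ∈ S → Quotient (inside ∷ K) (inside ∷ S)
  mergeHead {w} w∈K w∈S = record
    { size = size
    ; proj = proj′
    ; proj-kept = λ { here → proj-kept w∈K ; (there x∈K) → proj-kept x∈K }
    ; proj-surjective = λ i → Prod.map suc id (proj-surjective i)
    ; proj-merges = merges
    ; proj-separates = separates
    ; size≤ = m≤n⇒m≤1+n size≤
    ; size<-delete = λ _ → s≤s size≤
    ; size<-merge = λ _ _ _ → s≤s size≤ }
    where
      proj′ : Fin (suc n) → Maybe (Fin size)
      proj′ zero = proj w
      proj′ (suc x) = proj x
      merges : ∀ {x y} → x ∈ inside ∷ S → y ∈ inside ∷ S → proj′ x ≡ proj′ y
      merges here here = refl
      merges here (there y∈S) = proj-merges w∈S y∈S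
      merges (there x∈S) here = proj-merges x∈S w∈S
      merges (there x∈S) (there y∈S) = proj-merges x∈S y∈S
      in-S : ∀ {y} → w ≡ y ⊎ (w ∈ S × y ∈ S) → y ∈ S
      in-S (inj₁ refl) = w∈S
      in-S (inj₂ (_ , y∈S)) = y∈S
      separates : ∀ {x y i} → proj′ x ≡ just i → proj′ y ≡ just i →
                  x ≡ y ⊎ (x ∈ inside ∷ S × y ∈ inside ∷ S)
      separates {zero} {zero} _ _ = inj₁ refl
      separates {zero} {suc y} pw py = inj₂ (here , there (in-S (proj-separates pw py)))
      separates {suc x} {zero} px pw = inj₂ (there (in-S (proj-separates pw px)) , here)
      separates {suc x} {suc y} px py = suc-separated (proj-separates px py)

quotient : ∀ {n} (K S : Subset n) → S ⊆ K → Quotient K S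
quotient [] [] _ = emptyQuotient
quotient (outside ∷ K) (outside ∷ S) S⊆K = dropHead (quotient K S (drop-∷-⊆ S⊆K))
quotient (outside ∷ K) (inside ∷ S) S⊆K = contradiction (S⊆K here) λ ()
quotient (inside ∷ K) (outside ∷ S) S⊆K = freshHead (quotient K S (drop-∷-⊆ S⊆K)) λ ()
quotient (inside ∷ K) (inside ∷ S) S⊆K with nonempty? S
... | yes (w , w∈S) = mergeHead (quotient K S (drop-∷-⊆ S⊆K)) (drop-∷-⊆ S⊆K w∈S) w∈S
... | no S-empty = freshHead (quotient K S (drop-∷-⊆ S⊆K)) λ _ → S-empty

module QuotientDigraph {n} (G : Graph n) (D : OGraph n) (orient : IsOrientation G D)
                       {K S : Subset n} (Q : Quotient K S)
                       (S-convex : Convex D S) (S-connected : Connected G S) where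
  open Quotient Q
  open OrientedArcs G D orient

  QuotientArc : Fin size → Fin size → Set
  QuotientArc i j = i ≢ j × ∃₂ λ a b → proj a ≡ just i × proj b ≡ just j × arc D a b ≡ true

  quotientArc? : ∀ i j → Dec (QuotientArc i j)
  quotientArc? i j = ¬? (i ≟ j) ×-dec any? λ a → any? λ b →
    ≡-decᴹ _≟_ (proj a) (just i) ×-dec ≡-decᴹ _≟_ (proj b) (just j) ×-dec (arc D a b ≟ᵇ true)

  merged : ∀ {a b i j} → proj a ≡ just i → proj b ≡ just j → a ∈ S → b ∈ S → i ≡ j
  merged pa pb a∈S b∈S = just-injective (trans (sym pa) (trans (proj-merges a∈S b∈S) pb))

  -- A digon i ⇄ j would come from a 2-dipath through the convex set S.
  quotientArc-asym : ∀ {i j} → QuotientArc i j → ¬ QuotientArc j i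
  quotientArc-asym (i≢j , a , b , pa , pb , ab) (_ , c , d , pc , pd , cd)
    with proj-separates pa pd | proj-separates pb pc
  ... | inj₁ refl | inj₁ refl = true≢false (trans (sym cd) (antisym D a b ab))
  ... | inj₁ refl | inj₂ (b∈S , c∈S) = i≢j (merged pa pb (convex-centre D S-convex c∈S b∈S cd ab) b∈S)
  ... | inj₂ (a∈S , d∈S) | inj₁ refl = i≢j (merged pa pb a∈S (convex-centre D S-convex a∈S d∈S ab cd))
  ... | inj₂ (a∈S , _) | inj₂ (b∈S , _) = i≢j (merged pa pb a∈S b∈S)

  D/Q : OGraph size
  D/Q = record
    { arc = λ i j → does (quotientArc? i j)
    ; irrefl = λ i → dec-false (quotientArc? i i) λ ii → proj₁ ii refl
    ; antisym = λ i j ij → dec-false (quotientArc? j i) (quotientArc-asym (does-true (quotientArc? i j) ij)) }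

  G/Q≼G : underlying D/Q ≼ G
  G/Q≼G = record { branch = proj ; nonempty = proj-surjective ; connected = connected ; edges = edges }
    where
      connected : ∀ i v w → proj v ≡ just i → proj w ≡ just i → PathIn G (λ x → proj x ≡ just i) v w
      connected i v w pv pw with proj-separates pv pw
      ... | inj₁ refl = here
      ... | inj₂ (v∈S , w∈S) = mapPath (λ z∈S → trans (proj-merges z∈S v∈S) pv) (S-connected v∈S w∈S)
      edges : ∀ i j → adj (underlying D/Q) i j ≡ true →
              ∃₂ λ v w → proj v ≡ just i × proj w ≡ just j × adj G v w ≡ true
      edges i j ij with ∨-true ij
      ... | inj₁ i→j with does-true (quotientArc? i j) i→j
      ...   | _ , a , b , pa , pb , ab = a , b , pa , pb , arc⇒adj ab
      edges i j ij | inj₂ j→i with does-true (quotientArc? j i) j→i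
      ...   | _ , a , b , pa , pb , ab = b , a , pb , pa , arc⇒adjᵒ ab

  quotient-hasArc : ∀ {c d} → arc D c d ≡ true → c ∈ K → d ∈ K → ¬ (c ∈ S × d ∈ S) → HasArc D/Q
  quotient-hasArc {c} {d} cd c∈K d∈K notBoth with proj-kept c∈K | proj-kept d∈K
  ... | i , pc | j , pd with i ≟ j
  ...   | no i≢j = i , j , dec-true (quotientArc? i j) (i≢j , c , d , pc , pd , cd)
  ...   | yes refl with proj-separates pc pd
  ...     | inj₁ refl = contradiction refl (arc⇒≢ D cd)
  ...     | inj₂ both = contradiction both notBoth

  -- Vertices outside K carry no arcs, so the colour of a deleted vertex is arbitrary.
  lift-χs≤ : ∀ {k} → ArcsWithin D K → HasArc D/Q → χs≤ D/Q k → χs≤ D k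
  lift-χs≤ within (i₀ , _) (j , j≤k , T , ψ , hom , nontrivial) = j , j≤k , T , φ , φ-hom , φ-nontrivial
    where
      colour : Maybe (Fin size) → Fin j
      colour (just i) = ψ i
      colour nothing = ψ i₀
      φ : Fin n → Fin j
      φ = colour ∘ proj
      φ-hom : IsHomR D T φ
      φ-hom a b ab with proj-kept (proj₁ (within ab)) | proj-kept (proj₂ (within ab))
      ... | i , pa | i′ , pb rewrite pa | pb with i ≟ i′
      ...   | yes refl = rloop T (ψ i)
      ...   | no i≢i′ = hom i i′ (dec-true (quotientArc? i i′) (i≢i′ , a , b , pa , pb , ab))
      φ-nontrivial : ¬ Trivial D φ
      φ-nontrivial (c , trivial) = nontrivial (c , λ i i′ ii′ → monochrome (does-true (quotientArc? i i′) ii′))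
        where
          monochrome : ∀ {i i′} → QuotientArc i i′ → ψ i ≡ c × ψ i′ ≡ c
          monochrome (_ , a , b , pa , pb , ab) =
            trans (cong colour (sym pa)) (proj₁ (trivial a b ab)) ,
            trans (cong colour (sym pb)) (proj₂ (trivial a b ab))

-- Induction on the number of vertices

open ConvexHull

module _ {F : Family} (minorClosed : MinorClosed F) {k : ℕ} (χc : χcFamily≤ F k) where

  Bounded : ℕ → Set
  Bounded n = (G : Graph n) (D : OGraph n) → F G → IsOrientation G D → HasArc D → χs≤ D k

  boundedByQuotient : ∀ {n} → (∀ {m} → m < n → Bounded m) →
                      (G : Graph n) (D : OGraph n) → F G → (orient : IsOrientation G D) →
                      ∀ {K S} (Q : Quotient K S) → Convex D S → Connected G S → ArcsWithin D K →
                      ∀ {c d} → arc D c d ≡ true → c ∈ K → d ∈ K → ¬ (c ∈ S × d ∈ S) →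
                      Quotient.size Q < n → χs≤ D k
  boundedByQuotient smaller G D F-G orient Q S-convex S-connected within cd c∈K d∈K notBoth shrinks =
    lift-χs≤ within arc/Q
      (smaller shrinks (underlying D/Q) D/Q (minorClosed _ _ F-G G/Q≼G) (λ _ _ → refl) arc/Q)
    where
      open QuotientDigraph G D orient Q S-convex S-connected
      arc/Q : HasArc D/Q
      arc/Q = quotient-hasArc cd c∈K d∈K notBoth

  bounded : ∀ n → (∀ {m} → m < n → Bounded m) → Bounded n
  bounded n smaller G D F-G orient hasArc with completeConvex⊎properHull D
  ... | inj₁ cc = χ≤⇒χs≤ D hasArc (χc G D F-G orient cc)
  ... | inj₂ (a , b , ab , x , x∉H) with arcsWithin⊎arcLeaving D (hull D a b)
  ...   | inj₂ (c , d , cd , notBoth) =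
          boundedByQuotient smaller G D F-G orient Q (hull-convex D a b) (hull-connected D orient ab)
            (λ _ → ∈⊤ , ∈⊤) cd ∈⊤ ∈⊤ notBoth
            (Quotient.size<-merge Q (arc⇒≢ D ab) (∈-hullˡ D a b) (∈-hullʳ D a b))
    where
      Q : Quotient ⊤ (hull D a b)
      Q = quotient ⊤ (hull D a b) ⊆⊤
  ...   | inj₁ within =
          boundedByQuotient smaller G D F-G orient Q (λ _ _ _ a∈∅ → contradiction a∈∅ ∉⊥)
            (λ v∈∅ → contradiction v∈∅ ∉⊥) within ab (∈-hullˡ D a b) (∈-hullʳ D a b) (∉⊥ ∘ proj₁)
            (Quotient.size<-delete Q x∉H)
    where
      Q : Quotient (hull D a b) ∅
      Q = quotient (hull D a b) ∅ ⊥⊆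

  χcFamily≤⇒χsFamily≤ : χsFamily≤ F k
  χcFamily≤⇒χsFamily≤ {n} = <-rec Bounded bounded n

corollary36 : (F : Family) → MinorClosed F →
              (Σ ℕ λ n → Σ (Graph n) λ G → F G × HasEdge G) →
              ∀ (k : ℕ) → χsFamily≤ F k ⇔ χcFamily≤ F k
corollary36 F minorClosed hasEdge k =
  mk⇔ (χsFamily≤⇒χcFamily≤ hasEdge) (χcFamily≤⇒χsFamily≤ minorClosed)
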